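{- For every $n\ge 1$ and every set partition $A$ of $\{1,\dots,n\}$, \[ \mathtt{t}(A)+\mathtt{i}(A)=\binom{n}{2}, \] where $\mathtt{t}(A)$ is the depth index and $\mathtt{i}(A)$ is the intertwining number of $A$.
   Context: Arc diagram: list the elements of each block of $A$ in increasing order. An arc of $A$ is a pair $(i,j)$ with $i<j$ in the same block and no element of that block strictly between $i$ and $j$. Write $\mathrm{arcs}(A)$ for the set of arcs and $m=|\mathrm{arcs}(A)|$; note $m=n-(\text{number of blocks})$. Intertwining number: for two disjoint sets $B,C$ of integers, their intertwining number is the number of pairs $(b,c)\in B\times C$ such that $\{\min(b,c)+1,\dots,\max(b,c)-1\}\cap(B\cup C)=\emptyset$. $\mathtt{i}(A)$ is the sum of these numbers over all unordered pairs of distinct blocks of $A$. Equivalently, $\mathtt{i}(A)$ is the number of crossings in the extended arc diagram. This diagram is the arc diagram together with a half-arc $(-\infty,i)$ for each block minimum $i$ and a half-arc $(i,\infty)$ for each block maximum $i$. Two generalized arcs $(i,j),(k,\ell)$ cross if $i<k<j<\ell$. Depth index: for a vertex $v$, $\mathrm{depth}(v)$ is the number of arcs $(i,j)\in\mathrm{arcs}(A)$ with $i<v<j$. For an arc $\alpha=(u,v)$, $\mathrm{depth}(\alpha)$ is the number of arcs $(i,j)\in\mathrm{arcs}(A)$ with $i<u<v<j$. Then \[ \mathtt{t}(A)=\sum_{i=1}^{m}(n-i)-\sum_{v=1}^n\mathrm{depth}(v)+\sum_{\alpha\in\mathrm{arcs}(A)}\mathrm{depth}(\alpha), \] where $m$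 is the number of arcs of $A$. -}

module Defs where

open import Data.Bool using (Bool; true; false; _∧_; _∨_; not)
open import Data.Nat using (ℕ; zero; suc; _∸_; _<ᵇ_; _≡ᵇ_; _≟_)
open import Data.Fin using (Fin; toℕ)
open import Data.List using (List; []; _∷_; map; filterᵇ; length; upTo; allFin; cartesianProduct; deduplicate)
open import Data.Nat.ListAction using (sum)
open import Data.Bool.ListAction using (and)
open import Data.Product using (_×_; _,_)
open import Data.Integer using (ℤ; +_; _+_; _-_)

-- A set partition of {1,…,n} is encoded by a block-labelling  f : Fin n → ℕ :
-- two elements lie in the same block iff they carry the same label.
-- Element  x : Fin n  stands for  toℕ x + 1  (order preserving).

all : {A : Set} → (A → Bool) → List A → Bool
all p xs = and (map p xs)

module _ {n : ℕ} (f : Fin n → ℕ) where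

  _<F_ : Fin n → Fin n → Bool
  i <F j = toℕ i <ᵇ toℕ j

  same : Fin n → Fin n → Bool
  same i j = f i ≡ᵇ f j

  between : Fin n → Fin n → Fin n → Bool
  between i z j = (i <F z) ∧ (z <F j)

  positions : List (Fin n)
  positions = allFin n

  allPairs : List (Fin n × Fin n)
  allPairs = cartesianProduct positions positions

  isArc : Fin n × Fin n → Bool
  isArc (i , j) = (i <F j) ∧ same i j
                  ∧ all (λ z → not (between i z j ∧ same i z)) positions

  arcs : List (Fin n × Fin n)
  arcs = filterᵇ isArc allPairs

  depthVertex : Fin n → ℕ
  depthVertex v = length (filterᵇ (λ { (i , j) → between i v j }) arcs)

  depthArc : Fin n × Fin n → ℕ
  depthArc (u , v) = length (filterᵇ (λ { (i , j) → (i <F u) ∧ (v <F j) }) arcs)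

  tIndex : ℤ
  tIndex = (+ sum (map (λ i → n ∸ i) (map suc (upTo (length arcs)))))
           - (+ sum (map depthVertex positions))
           + (+ sum (map depthArc arcs))

  blockLabels : List ℕ
  blockLabels = deduplicate _≟_ (map f positions)

  intertwin : ℕ → ℕ → ℕ
  intertwin a b = length (filterᵇ ok allPairs)
    where
      inBC : Fin n → Bool
      inBC z = (f z ≡ᵇ a) ∨ (f z ≡ᵇ b)
      strictlyBetween : Fin n → Fin n → Fin n → Bool
      strictlyBetween x z y = between x z y ∨ between y z x
      ok : Fin n × Fin n → Bool
      ok (x , y) = (f x ≡ᵇ a) ∧ (f y ≡ᵇ b)
                   ∧ all (λ z → not (strictlyBetween x z y ∧ inBC z)) positions

  -- i(A): sum over unordered pairs of distinct blocks (labels a < b)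
  iNumber : ℕ
  iNumber = sum (map (λ { (a , b) → if' (a <ᵇ b) (intertwin a b) }) (cartesianProduct blockLabels blockLabels))
    where
      if' : Bool → ℕ → ℕ
      if' true  k = k
      if' false _ = 0

-- Moving the subtracted vertex depths across,
-- the theorem becomes the identity  Balanced n f  over ℕ:
--     Σ_{i=1}^{m} (n - i) + Σ_α depth α + i(A) = C(n,2) + Σ_v depth v,
-- proved by induction on n by prepending a position labelled c to a labelling g.
-- The right side grows by n (C(n+1,2) = C(n,2) + n) plus the positions under the new arc.
--  * c new: the singleton block adds no arc; the first sum grows by m, and each of the
--    n - m old block minima forms one new intertwining pair.
--  * c occurs, first at e: the new arc (0 , e) makes the first sum grow by n. Every
--    position before e is either a block minimum (a new intertwining pair) or the end of
--    exactly one arc (an arc now under the new one), and so it balances its new depth.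

module Submission where

open import Defs
open import Data.Bool using (Bool; true; false; _∧_; _∨_; not; T)
open import Data.Bool.Properties using (∧-zeroʳ; ∨-identityˡ; ∨-identityʳ; ∨-comm)
open import Data.Bool.ListAction using (and)
open import Data.Nat using (ℕ; zero; suc; _+_; _*_; _∸_; _<ᵇ_; _≡ᵇ_; _≟_; _≤_)
open import Data.Nat.Properties
open import Data.Nat.Tactic.RingSolver using (solve-∀)
open import Data.Nat.Combinatorics using (_C_; nCk+nC[k+1]≡[n+1]C[k+1]; nC1≡n)
open import Data.Nat.ListAction using (sum)
open import Data.Nat.ListAction.Properties using (sum-++)
open import Data.Fin using (Fin; toℕ; zero; suc)
open import Data.Fin.Properties using (toℕ<n)
open import Data.List using (List; []; _∷_; map; filterᵇ; length; upTo; applyUpTo; allFin; cartesianProduct; _++_)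
open import Data.List.Properties using (map-tabulate; map-cong; map-++; map-∘; map-applyUpTo)
open import Data.List.Membership.Propositional using (_∈_)
open import Data.List.Membership.Propositional.Properties using (∈-map⁺; ∈-allFin; ∈-deduplicate⁺)
open import Data.List.Relation.Unary.Any using (here; there)
open import Data.List.Relation.Unary.All as All using (All; _∷_)
open import Data.List.Relation.Unary.Unique.Propositional using (Unique; _∷_)
open import Data.List.Relation.Unary.Unique.DecPropositional.Properties _≟_ using (deduplicate-!)
open import Data.Product using (_×_; _,_)
open import Data.Empty using (⊥; ⊥-elim)
import Data.Integer as ℤ
open import Data.Integer.Properties using (pos-+)
import Data.Integer.Tactic.RingSolver as ℤ-Solver
open import Algebra.Properties.Semiring.Sum +-*-semiring
  using (sum-syntax; sum-cong-≗; sum-replicate-zero; ∑-distrib-+; ∑-comm; *-distribˡ-sum; *-distribʳ-sum)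
  renaming (sum to ∑)
open import Relation.Binary.PropositionalEquality

χ : Bool → ℕ
χ true  = 1
χ false = 0

χ-∧ : ∀ a b → χ (a ∧ b) ≡ χ a * χ b
χ-∧ true  b = sym (+-identityʳ (χ b))
χ-∧ false b = refl

∑-const : ∀ n k → ∑[ i < n ] k ≡ n * k
∑-const zero    k = refl
∑-const (suc n) k = cong (k +_) (∑-const n k)

∑-zero : ∀ {n} {h : Fin n → ℕ} → (∀ i → h i ≡ 0) → ∑ h ≡ 0
∑-zero {n} eq = trans (sum-cong-≗ eq) (sum-replicate-zero n)

∑-ones : ∀ {n} {h : Fin n → ℕ} → (∀ i → h i ≡ 1) → ∑ h ≡ n
∑-ones {n} eq = trans (sum-cong-≗ eq) (trans (∑-const n 1) (*-identityʳ n))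

every : ∀ n → (Fin n → Bool) → Bool
every zero    p = true
every (suc n) p = p zero ∧ every n (λ i → p (suc i))

some : ∀ n → (Fin n → Bool) → Bool
some zero    p = false
some (suc n) p = p zero ∨ some n (λ i → p (suc i))

every-true : ∀ n {p : Fin n → Bool} → (∀ i → p i ≡ true) → every n p ≡ true
every-true zero    eq = refl
every-true (suc n) eq rewrite eq zero = every-true n (λ i → eq (suc i))

every-cong : ∀ n {p q : Fin n → Bool} → (∀ i → p i ≡ q i) → every n p ≡ every n q
every-cong zero    eq = refl
every-cong (suc n) eq = cong₂ _∧_ (eq zero) (every-cong n (λ i → eq (suc i)))

every-∧ : ∀ n (p q : Fin n → Bool) → every n (λ i → p i ∧ q i) ≡ every n p ∧ every n q
every-∧ zero    p q = refl
every-∧ (suc n) p q =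
  trans (cong ((p zero ∧ q zero) ∧_) (every-∧ n (λ i → p (suc i)) (λ i → q (suc i))))
        (interchange (p zero) (q zero) _ _)
  where
  interchange : ∀ a b c d → (a ∧ b) ∧ (c ∧ d) ≡ (a ∧ c) ∧ (b ∧ d)
  interchange true  true  c d = refl
  interchange true  false c d = sym (∧-zeroʳ c)
  interchange false b     c d = refl

some-false : ∀ n {p : Fin n → Bool} → some n p ≡ false → ∀ i → p i ≡ false
some-false (suc n) {p} e zero with p zero
... | false = refl
some-false (suc n) {p} e (suc i) with p zero
... | false = some-false n e i

map-allFin-suc : ∀ {A : Set} n (h : Fin (suc n) → A) →
                 map h (allFin (suc n)) ≡ h zero ∷ map (λ i → h (suc i)) (allFin n)
map-allFin-suc n h =
  cong (h zero ∷_) (trans (map-tabulate suc h) (sym (map-tabulate (λ i → i) (λ i → h (suc i)))))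

sum-allFin : ∀ n (h : Fin n → ℕ) → sum (map h (allFin n)) ≡ ∑ h
sum-allFin zero    h = refl
sum-allFin (suc n) h =
  trans (cong sum (map-allFin-suc n h)) (cong (h zero +_) (sum-allFin n (λ i → h (suc i))))

all-allFin : ∀ n (p : Fin n → Bool) → all p (allFin n) ≡ every n p
all-allFin zero    p = refl
all-allFin (suc n) p =
  trans (cong and (map-allFin-suc n p)) (cong (p zero ∧_) (all-allFin n (λ i → p (suc i))))

sum-cong : ∀ {A : Set} {h k : A → ℕ} (xs : List A) → (∀ x → h x ≡ k x) → sum (map h xs) ≡ sum (map k xs)
sum-cong xs eq = cong sum (map-cong eq xs)

length-filter : ∀ {A : Set} (p : A → Bool) (xs : List A) → length (filterᵇ p xs) ≡ sum (map (λ x → χ (p x)) xs)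
length-filter p []       = refl
length-filter p (x ∷ xs) with p x
... | true  = cong suc (length-filter p xs)
... | false = length-filter p xs

sum-filter : ∀ {A : Set} (p : A → Bool) (h : A → ℕ) (xs : List A) →
             sum (map h (filterᵇ p xs)) ≡ sum (map (λ x → χ (p x) * h x) xs)
sum-filter p h []       = refl
sum-filter p h (x ∷ xs) with p x
... | true  = cong₂ _+_ (sym (+-identityʳ (h x))) (sum-filter p h xs)
... | false = sum-filter p h xs

sum-cartesianProduct : ∀ {A B : Set} (h : A × B → ℕ) (xs : List A) (ys : List B) →
  sum (map h (cartesianProduct xs ys)) ≡ sum (map (λ x → sum (map (λ y → h (x , y)) ys)) xs)
sum-cartesianProduct h []       ys = refl
sum-cartesianProduct h (x ∷ xs) ys = begin
    sum (map h (map (x ,_) ys ++ cartesianProduct xs ys))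
  ≡⟨ cong sum (map-++ h (map (x ,_) ys) _) ⟩
    sum (map h (map (x ,_) ys) ++ map h (cartesianProduct xs ys))
  ≡⟨ sum-++ (map h (map (x ,_) ys)) _ ⟩
    sum (map h (map (x ,_) ys)) + sum (map h (cartesianProduct xs ys))
  ≡⟨ cong₂ _+_ (cong sum (sym (map-∘ ys))) (sum-cartesianProduct h xs ys) ⟩
    sum (map (λ y → h (x , y)) ys) + sum (map (λ x → sum (map (λ y → h (x , y)) ys)) xs)
  ∎
  where open ≡-Reasoning

sum-allPairs : ∀ n (h : Fin n × Fin n → ℕ) →
               sum (map h (cartesianProduct (allFin n) (allFin n))) ≡ ∑[ x < n ] ∑[ y < n ] h (x , y)
sum-allPairs n h =
  trans (sum-cartesianProduct h (allFin n) (allFin n))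
        (trans (sum-cong (allFin n) (λ x → sum-allFin n _)) (sum-allFin n _))

sum-∑-comm : ∀ {A : Set} (xs : List A) n (h : A → Fin n → ℕ) →
             sum (map (λ a → ∑ (h a)) xs) ≡ ∑[ i < n ] sum (map (λ a → h a i) xs)
sum-∑-comm []       n h = sym (∑-zero {n} (λ _ → refl))
sum-∑-comm (x ∷ xs) n h = trans (cong (∑ (h x) +_) (sum-∑-comm xs n h)) (sym (∑-distrib-+ (h x) _))

sum-*ˡ : ∀ {A : Set} (xs : List A) (c : ℕ) (h : A → ℕ) → c * sum (map h xs) ≡ sum (map (λ a → c * h a) xs)
sum-*ˡ []       c h = *-zeroʳ c
sum-*ˡ (x ∷ xs) c h = trans (*-distribˡ-+ c (h x) _) (cong (c * h x +_) (sum-*ˡ xs c h))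

≡ᵇ-sym : ∀ a b → (a ≡ᵇ b) ≡ (b ≡ᵇ a)
≡ᵇ-sym zero    zero    = refl
≡ᵇ-sym zero    (suc b) = refl
≡ᵇ-sym (suc a) zero    = refl
≡ᵇ-sym (suc a) (suc b) = ≡ᵇ-sym a b

≡ᵇ-refl : ∀ a → (a ≡ᵇ a) ≡ true
≡ᵇ-refl zero    = refl
≡ᵇ-refl (suc a) = ≡ᵇ-refl a

≡ᵇ-true : ∀ a b → (a ≡ᵇ b) ≡ true → a ≡ b
≡ᵇ-true a b e = ≡ᵇ⇒≡ a b (subst T (sym e) _)

≡ᵇ-false : ∀ a b → (a ≡ b → ⊥) → (a ≡ᵇ b) ≡ false
≡ᵇ-false zero    zero    a≢b = ⊥-elim (a≢b refl)
≡ᵇ-false zero    (suc b) a≢b = refl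
≡ᵇ-false (suc a) zero    a≢b = refl
≡ᵇ-false (suc a) (suc b) a≢b = ≡ᵇ-false a b (λ e → a≢b (cong suc e))

<ᵇ-irrefl : ∀ a → (a <ᵇ a) ≡ false
<ᵇ-irrefl zero    = refl
<ᵇ-irrefl (suc a) = <ᵇ-irrefl a

<ᵇ-trichotomy : ∀ a b → χ (a <ᵇ b) + χ (b <ᵇ a) ≡ χ (not (a ≡ᵇ b))
<ᵇ-trichotomy zero    zero    = refl
<ᵇ-trichotomy zero    (suc b) = refl
<ᵇ-trichotomy (suc a) zero    = refl
<ᵇ-trichotomy (suc a) (suc b) = <ᵇ-trichotomy a b

_≺_ : ∀ {n} → Fin n → Fin n → Bool
i ≺ j = toℕ i <ᵇ toℕ j

module _ {n : ℕ} (f : Fin n → ℕ) where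

  arc : Fin n → Fin n → Bool
  arc x y = x ≺ y ∧ ((f x ≡ᵇ f y) ∧ every n (λ z → not ((x ≺ z ∧ z ≺ y) ∧ (f x ≡ᵇ f z))))

  arcCount : ℕ
  arcCount = ∑[ x < n ] ∑[ y < n ] χ (arc x y)

  depthOfVertex : Fin n → ℕ
  depthOfVertex v = ∑[ x < n ] ∑[ y < n ] (χ (arc x y) * χ (x ≺ v ∧ v ≺ y))

  depthOfArc : Fin n → Fin n → ℕ
  depthOfArc u v = ∑[ i < n ] ∑[ j < n ] (χ (arc i j) * χ (i ≺ u ∧ v ≺ j))

  vertexDepths : ℕ
  vertexDepths = ∑[ v < n ] depthOfVertex v

  arcDepths : ℕ
  arcDepths = ∑[ u < n ] ∑[ v < n ] (χ (arc u v) * depthOfArc u v)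

  clear : ℕ → ℕ → Fin n → Fin n → Bool
  clear a b x y = every n (λ z → not (((x ≺ z ∧ z ≺ y) ∨ (y ≺ z ∧ z ≺ x)) ∧ ((f z ≡ᵇ a) ∨ (f z ≡ᵇ b))))

  intertwinings : ℕ
  intertwinings = ∑[ x < n ] ∑[ y < n ] (χ (f x <ᵇ f y) * χ (clear (f x) (f y) x y))

  isArc≡arc : ∀ x y → isArc f (x , y) ≡ arc x y
  isArc≡arc x y = cong (λ b → x ≺ y ∧ ((f x ≡ᵇ f y) ∧ b)) (all-allFin n _)

  count-arcs : (q : Fin n × Fin n → Bool) →
               length (filterᵇ q (arcs f)) ≡ ∑[ x < n ] ∑[ y < n ] (χ (arc x y) * χ (q (x , y)))
  count-arcs q =
    trans (length-filter q (arcs f))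
   (trans (sum-filter (isArc f) (λ p → χ (q p)) (allPairs f))
   (trans (sum-allPairs n _)
          (sum-cong-≗ {n} λ x → sum-cong-≗ {n} λ y → cong (λ b → χ b * χ (q (x , y))) (isArc≡arc x y))))

  arcCount-conv : length (arcs f) ≡ arcCount
  arcCount-conv =
    trans (length-filter _ (allPairs f))
   (trans (sum-allPairs n _) (sum-cong-≗ {n} λ x → sum-cong-≗ {n} λ y → cong χ (isArc≡arc x y)))

  vertexDepths-conv : sum (map (depthVertex f) (positions f)) ≡ vertexDepths
  vertexDepths-conv = trans (sum-allFin n _) (sum-cong-≗ {n} (λ v → count-arcs _))

  arcDepths-conv : sum (map (depthArc f) (arcs f)) ≡ arcDepths
  arcDepths-conv =
    trans (sum-filter (isArc f) (depthArc f) (allPairs f))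
   (trans (sum-allPairs n _)
          (sum-cong-≗ {n} λ u → sum-cong-≗ {n} λ v → cong₂ (λ b t → χ b * t) (isArc≡arc u v) (count-arcs _)))

  intertwin-conv : ∀ a b →
    intertwin f a b ≡ ∑[ x < n ] ∑[ y < n ] χ ((f x ≡ᵇ a) ∧ ((f y ≡ᵇ b) ∧ clear a b x y))
  intertwin-conv a b =
    trans (length-filter _ (allPairs f))
   (trans (sum-allPairs n _)
          (sum-cong-≗ {n} λ x → sum-cong-≗ {n} λ y →
             cong (λ t → χ ((f x ≡ᵇ a) ∧ ((f y ≡ᵇ b) ∧ t))) (all-allFin n _)))

sum-select-absent : ∀ (D : List ℕ) c (G : ℕ → ℕ) → All (λ a → c ≡ a → ⊥) D →
                    sum (map (λ a → χ (c ≡ᵇ a) * G a) D) ≡ 0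
sum-select-absent []      c G _          = refl
sum-select-absent (d ∷ D) c G (c≢d ∷ ds) rewrite ≡ᵇ-false c d c≢d = sum-select-absent D c G ds

sum-select : ∀ (D : List ℕ) c (G : ℕ → ℕ) → Unique D → c ∈ D →
             sum (map (λ a → χ (c ≡ᵇ a) * G a) D) ≡ G c
sum-select (d ∷ D) c G (d∉D ∷ u) (here refl)
  rewrite ≡ᵇ-refl c | sum-select-absent D c G d∉D = trans (+-identityʳ _) (+-identityʳ _)
sum-select (d ∷ D) c G (d∉D ∷ u) (there c∈D)
  rewrite ≡ᵇ-false c d (λ e → All.lookup d∉D c∈D (sym e)) = sum-select D c G u c∈D

-- iNumber f sums, over pairs of block labels, a summand local to its definition;
-- matching iNumber f against its unfolding recovers that summand.
summandOf : {H : ℕ × ℕ → ℕ} {D : List ℕ} (x : ℕ) → x ≡ sum (map H (cartesianProduct D D)) → ℕ × ℕ → ℕ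
summandOf {H} _ _ = H

module _ {n : ℕ} (f : Fin n → ℕ) where
  private
    D : List ℕ
    D = blockLabels f

    iSummand : ℕ × ℕ → ℕ
    iSummand = summandOf {D = D} (iNumber f) refl

    iSummand≡ : ∀ a b → iSummand (a , b) ≡ χ (a <ᵇ b) * intertwin f a b
    iSummand≡ a b with a <ᵇ b
    ... | true  = sym (+-identityʳ _)
    ... | false = refl

    D-unique : Unique D
    D-unique = deduplicate-! (map f (allFin n))

    label∈D : ∀ x → f x ∈ D
    label∈D x = ∈-deduplicate⁺ _≟_ (∈-map⁺ f (∈-allFin x))

    term : ℕ → ℕ → Fin n → Fin n → ℕ
    term a b x y = χ (a <ᵇ b) * χ ((f x ≡ᵇ a) ∧ ((f y ≡ᵇ b) ∧ clear f a b x y))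

    term-factor : ∀ k p q w → k * χ (p ∧ (q ∧ w)) ≡ χ p * (χ q * (k * χ w))
    term-factor k true  true  w = sym (trans (+-identityʳ _) (+-identityʳ _))
    term-factor k true  false w = *-zeroʳ k
    term-factor k false q     w = *-zeroʳ k

    -- for fixed positions only the labels a = f x, b = f y contribute
    select-labels : ∀ x y → sum (map (λ a → sum (map (λ b → term a b x y) D)) D)
                            ≡ χ (f x <ᵇ f y) * χ (clear f (f x) (f y) x y)
    select-labels x y = begin
        sum (map (λ a → sum (map (λ b → term a b x y) D)) D)
      ≡⟨ sum-cong D (λ a → trans (sum-cong D (λ b → term-factor (χ (a <ᵇ b)) (f x ≡ᵇ a) (f y ≡ᵇ b) _))
                                  (sym (sum-*ˡ D (χ (f x ≡ᵇ a)) _))) ⟩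
        sum (map (λ a → χ (f x ≡ᵇ a) * sum (map (λ b → χ (f y ≡ᵇ b) * (χ (a <ᵇ b) * χ (clear f a b x y))) D)) D)
      ≡⟨ sum-select D (f x) _ D-unique (label∈D x) ⟩
        sum (map (λ b → χ (f y ≡ᵇ b) * (χ (f x <ᵇ b) * χ (clear f (f x) b x y))) D)
      ≡⟨ sum-select D (f y) _ D-unique (label∈D y) ⟩
        χ (f x <ᵇ f y) * χ (clear f (f x) (f y) x y)
      ∎
      where open ≡-Reasoning

  intertwinings-conv : iNumber f ≡ intertwinings f
  intertwinings-conv = begin
      iNumber f
    ≡⟨ sum-cartesianProduct iSummand D D ⟩
      sum (map (λ a → sum (map (λ b → iSummand (a , b)) D)) D)
    ≡⟨ sum-cong D (λ a → sum-cong D (λ b → expand a b)) ⟩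
      sum (map (λ a → sum (map (λ b → ∑[ x < n ] ∑[ y < n ] term a b x y) D)) D)
    ≡⟨ sum-cong D (λ a → trans (sum-∑-comm D n (λ b x → ∑ (term a b x)))
                               (sum-cong-≗ {n} λ x → sum-∑-comm D n (λ b y → term a b x y))) ⟩
      sum (map (λ a → ∑[ x < n ] ∑[ y < n ] sum (map (λ b → term a b x y) D)) D)
    ≡⟨ trans (sum-∑-comm D n (λ a x → ∑[ y < n ] sum (map (λ b → term a b x y) D)))
             (sum-cong-≗ {n} λ x → sum-∑-comm D n (λ a y → sum (map (λ b → term a b x y) D))) ⟩
      ∑[ x < n ] ∑[ y < n ] sum (map (λ a → sum (map (λ b → term a b x y) D)) D)
    ≡⟨ sum-cong-≗ {n} (λ x → sum-cong-≗ {n} (λ y → select-labels x y)) ⟩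
      intertwinings f
    ∎
    where
    open ≡-Reasoning
    expand : ∀ a b → iSummand (a , b) ≡ ∑[ x < n ] ∑[ y < n ] term a b x y
    expand a b = begin
        iSummand (a , b)
      ≡⟨ iSummand≡ a b ⟩
        χ (a <ᵇ b) * intertwin f a b
      ≡⟨ cong (χ (a <ᵇ b) *_) (intertwin-conv f a b) ⟩
        χ (a <ᵇ b) * (∑[ x < n ] ∑[ y < n ] χ ((f x ≡ᵇ a) ∧ ((f y ≡ᵇ b) ∧ clear f a b x y)))
      ≡⟨ trans (*-distribˡ-sum {n} (χ (a <ᵇ b)) _) (sum-cong-≗ {n} λ x → *-distribˡ-sum {n} (χ (a <ᵇ b)) _) ⟩
        ∑[ x < n ] ∑[ y < n ] term a b x y
      ∎

isBlockMin : ∀ {n} → (Fin n → ℕ) → Fin n → Bool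
isBlockMin {n} g v = every n (λ z → not (z ≺ v ∧ (g z ≡ᵇ g v)))

noEarlier : ∀ {n} → ℕ → (Fin n → ℕ) → Fin n → Bool
noEarlier {n} c g y = every n (λ z → not (z ≺ y ∧ (c ≡ᵇ g z)))

firstOcc : ∀ {n} → ℕ → (Fin n → ℕ) → Fin n → Bool
firstOcc c g y = (c ≡ᵇ g y) ∧ noEarlier c g y

occurs : ∀ {n} → ℕ → (Fin n → ℕ) → Bool
occurs {n} c g = some n (λ j → c ≡ᵇ g j)

blockMin-or-arcEnd : ∀ n (g : Fin n → ℕ) v → χ (isBlockMin g v) + ∑[ u < n ] χ (arc g u v) ≡ 1
blockMin-or-arcEnd (suc n) g zero =
  cong₂ (λ a b → χ a + b) (every-true n (λ _ → refl)) (∑-zero {n} (λ _ → refl))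
blockMin-or-arcEnd (suc n) g (suc v) = step (g zero) (blockMin-or-arcEnd n g′ v)
  where
  g′ : Fin n → ℕ
  g′ i = g (suc i)
  -- a first position labelled d = g′ v turns the block minimum v into the end of the
  -- arc (0 , v); any other label leaves the position v unchanged
  step : ∀ d → χ (isBlockMin g′ v) + ∑[ u < n ] χ (arc g′ u v) ≡ 1 →
         χ (not (d ≡ᵇ g′ v) ∧ isBlockMin g′ v) + (χ (firstOcc d g′ v) + ∑[ u < n ] χ (arc g′ u v)) ≡ 1
  step d ih with d ≡ᵇ g′ v in eq
  ... | false = ih
  ... | true  = trans (cong (λ t → χ t + ∑[ u < n ] χ (arc g′ u v)) noEarlier≡isBlockMin) ih
    where
    d≡g′v : d ≡ g′ v
    d≡g′v = ≡ᵇ-true d (g′ v) eq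
    noEarlier≡isBlockMin : noEarlier d g′ v ≡ isBlockMin g′ v
    noEarlier≡isBlockMin = every-cong n (λ z →
      cong (λ t → not (z ≺ v ∧ t)) (trans (cong (_≡ᵇ g′ z) d≡g′v) (≡ᵇ-sym (g′ v) (g′ z))))

arcs+blockMins : ∀ n (g : Fin n → ℕ) → arcCount g + ∑[ y < n ] χ (isBlockMin g y) ≡ n
arcs+blockMins n g = begin
    arcCount g + ∑[ y < n ] χ (isBlockMin g y)
  ≡⟨ cong (_+ ∑[ y < n ] χ (isBlockMin g y)) (∑-comm (λ u v → χ (arc g u v))) ⟩
    ∑[ v < n ] ∑[ u < n ] χ (arc g u v) + ∑[ y < n ] χ (isBlockMin g y)
  ≡⟨ +-comm (∑[ v < n ] ∑[ u < n ] χ (arc g u v)) _ ⟩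
    ∑[ y < n ] χ (isBlockMin g y) + ∑[ v < n ] ∑[ u < n ] χ (arc g u v)
  ≡⟨ sym (∑-distrib-+ {n} _ _) ⟩
    ∑[ v < n ] (χ (isBlockMin g v) + ∑[ u < n ] χ (arc g u v))
  ≡⟨ ∑-ones (blockMin-or-arcEnd n g) ⟩
    n
  ∎
  where open ≡-Reasoning

firstOcc-unique : ∀ n (g : Fin n → ℕ) c → occurs c g ≡ true → ∑[ y < n ] χ (firstOcc c g y) ≡ 1
firstOcc-unique (suc n) g c occ = step (g zero) occ (firstOcc-unique n g′ c)
  where
  g′ : Fin n → ℕ
  g′ i = g (suc i)
  -- a first position labelled c is the first occurrence; otherwise it lies in the tail
  step : ∀ d → ((c ≡ᵇ d) ∨ occurs c g′) ≡ true →
         (occurs c g′ ≡ true → ∑[ y < n ] χ (firstOcc c g′ y) ≡ 1) →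
         χ ((c ≡ᵇ d) ∧ every n (λ _ → true))
           + ∑[ y < n ] χ ((c ≡ᵇ g′ y) ∧ (not (c ≡ᵇ d) ∧ noEarlier c g′ y)) ≡ 1
  step d occ ih with c ≡ᵇ d
  ... | true  = cong₂ (λ a b → χ a + b) (every-true n (λ _ → refl))
                      (∑-zero {n} (λ y → cong χ (∧-zeroʳ (c ≡ᵇ g′ y))))
  ... | false = ih occ

beforeFirstOcc : ∀ n (g : Fin n → ℕ) c → occurs c g ≡ true → ∀ y →
                 χ (not (c ≡ᵇ g y) ∧ noEarlier c g y) ≡ ∑[ j < n ] χ (y ≺ j ∧ firstOcc c g j)
beforeFirstOcc (suc n) g c occ zero = atHead (g zero) occ
  where
  g′ : Fin n → ℕ
  g′ i = g (suc i)
  atHead : ∀ d → ((c ≡ᵇ d) ∨ occurs c g′) ≡ true →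
           χ (not (c ≡ᵇ d) ∧ every n (λ _ → true))
             ≡ ∑[ j < n ] χ ((c ≡ᵇ g′ j) ∧ (not (c ≡ᵇ d) ∧ noEarlier c g′ j))
  atHead d occ with c ≡ᵇ d
  ... | true  = sym (∑-zero {n} (λ j → cong χ (∧-zeroʳ (c ≡ᵇ g′ j))))
  ... | false = trans (cong χ (every-true n (λ _ → refl))) (sym (firstOcc-unique n g′ c occ))
beforeFirstOcc (suc n) g c occ (suc y) = later (g zero) occ
  where
  g′ : Fin n → ℕ
  g′ i = g (suc i)
  -- a first position labelled c makes both sides vanish; otherwise recurse on the tail
  later : ∀ d → ((c ≡ᵇ d) ∨ occurs c g′) ≡ true →
          χ (not (c ≡ᵇ g′ y) ∧ (not (c ≡ᵇ d) ∧ noEarlier c g′ y))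
            ≡ ∑[ j < n ] χ (y ≺ j ∧ ((c ≡ᵇ g′ j) ∧ (not (c ≡ᵇ d) ∧ noEarlier c g′ j)))
  later d occ with c ≡ᵇ d
  ... | false = beforeFirstOcc n g′ c occ y
  ... | true  = trans (cong χ (∧-zeroʳ (not (c ≡ᵇ g′ y))))
                      (sym (∑-zero {n} (λ j → cong χ
                        (trans (cong (y ≺ j ∧_) (∧-zeroʳ (c ≡ᵇ g′ j))) (∧-zeroʳ (y ≺ j))))))

triangle : ℕ → ℕ → ℕ
triangle n m = ∑[ i < m ] (n ∸ suc (toℕ i))

sum-applyUpTo : ∀ (h : ℕ → ℕ) m → sum (applyUpTo h m) ≡ ∑[ i < m ] h (toℕ i)
sum-applyUpTo h zero    = refl
sum-applyUpTo h (suc m) = cong (h 0 +_) (sum-applyUpTo (λ i → h (suc i)) m)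

triangle-conv : ∀ n m → sum (map (λ i → n ∸ i) (map suc (upTo m))) ≡ triangle n m
triangle-conv n m =
  trans (cong sum (trans (cong (map (n ∸_)) (map-applyUpTo (λ i → i) suc m)) (map-applyUpTo suc (n ∸_) m)))
        (sum-applyUpTo (λ i → n ∸ suc i) m)

triangle-suc-suc : ∀ n m → triangle (suc n) (suc m) ≡ n + triangle n m
triangle-suc-suc n m = refl

triangle-suc : ∀ n m → m ≤ n → triangle (suc n) m ≡ m + triangle n m
triangle-suc n m m≤n = begin
    ∑[ i < m ] (n ∸ toℕ i)
  ≡⟨ sum-cong-≗ {m} (λ i → +-∸-assoc 1 (≤-trans (toℕ<n i) m≤n)) ⟩
    ∑[ i < m ] (1 + (n ∸ suc (toℕ i)))
  ≡⟨ ∑-distrib-+ {m} (λ _ → 1) _ ⟩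
    ∑[ i < m ] 1 + triangle n m
  ≡⟨ cong (_+ triangle n m) (∑-ones {m} (λ _ → refl)) ⟩
    m + triangle n m
  ∎
  where open ≡-Reasoning

Balanced : ∀ n → (Fin n → ℕ) → Set
Balanced n f = triangle n (arcCount f) + arcDepths f + intertwinings f ≡ n C 2 + vertexDepths f

C2-suc : ∀ n → suc n C 2 ≡ n C 2 + n
C2-suc n = trans (sym (nCk+nC[k+1]≡[n+1]C[k+1] n 1)) (trans (cong (_+ n C 2) (nC1≡n n)) (+-comm n (n C 2)))

propagate : ∀ {T E I D c n ΔT ΔE ΔI ΔD} → T + E + I ≡ c + D → ΔT + ΔE + ΔI ≡ n + ΔD →
            (ΔT + T) + (ΔE + E) + (ΔI + I) ≡ (c + n) + (ΔD + D)
propagate {T} {E} {I} {D} {c} {n} {ΔT} {ΔE} {ΔI} {ΔD} old increments = begin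
    (ΔT + T) + (ΔE + E) + (ΔI + I)
  ≡⟨ regroupˡ T E I ΔT ΔE ΔI ⟩
    (T + E + I) + (ΔT + ΔE + ΔI)
  ≡⟨ cong₂ _+_ old increments ⟩
    (c + D) + (n + ΔD)
  ≡⟨ regroupʳ c D n ΔD ⟩
    (c + n) + (ΔD + D)
  ∎
  where
  open ≡-Reasoning
  regroupˡ : ∀ T E I ΔT ΔE ΔI → (ΔT + T) + (ΔE + E) + (ΔI + I) ≡ (T + E + I) + (ΔT + ΔE + ΔI)
  regroupˡ = solve-∀
  regroupʳ : ∀ c D n ΔD → (c + D) + (n + ΔD) ≡ (c + n) + (ΔD + D)
  regroupʳ = solve-∀

module Prepend {n : ℕ} (f : Fin (suc n) → ℕ) where

  c : ℕ
  c = f zero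

  g : Fin n → ℕ
  g i = f (suc i)

  -- the new position is joined by an arc to the first occurrence of c in g, if any
  newArcEnd : Fin n → Bool
  newArcEnd = firstOcc c g

  underNewArc : Fin n → ℕ
  underNewArc v = ∑[ j < n ] (χ (newArcEnd j) * χ (v ≺ j))

  firstOfBoth : Fin n → Bool
  firstOfBoth y = every n (λ z → not (z ≺ y ∧ ((g z ≡ᵇ c) ∨ (g z ≡ᵇ g y))))

  newArcs newVertexDepth newArcDepth newPairs : ℕ
  newArcs        = ∑[ y < n ] χ (newArcEnd y)
  newVertexDepth = ∑[ v < n ] underNewArc v
  newArcDepth    = ∑[ u < n ] ∑[ v < n ] (χ (arc g u v) * underNewArc v)
  newPairs       = ∑[ y < n ] (χ (not (c ≡ᵇ g y)) * χ (firstOfBoth y))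

  arcCount-step : arcCount f ≡ newArcs + arcCount g
  arcCount-step = refl

  -- The new position lies under no arc; an old position gains the new arc iff under it.
  vertexDepths-step : vertexDepths f ≡ newVertexDepth + vertexDepths g
  vertexDepths-step = begin
      vertexDepths f
    ≡⟨ cong (_+ ∑[ v < n ] (underNewArc v + depthOfVertex g v)) firstVertexUncovered ⟩
      ∑[ v < n ] (underNewArc v + depthOfVertex g v)
    ≡⟨ ∑-distrib-+ {n} underNewArc (depthOfVertex g) ⟩
      newVertexDepth + vertexDepths g
    ∎
    where
    open ≡-Reasoning
    firstVertexUncovered : depthOfVertex f zero ≡ 0
    firstVertexUncovered = ∑-zero {suc n} (λ x → ∑-zero {suc n} (λ y → *-zeroʳ (χ (arc f x y))))

  -- Arcs from the new position lie under no arc; an old arc gains the new arc iff under it.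
  arcDepths-step : arcDepths f ≡ newArcDepth + arcDepths g
  arcDepths-step = begin
      arcDepths f
    ≡⟨ cong (_+ ∑[ u < n ] ∑[ v < n ] (χ (arc g u v) * (underNewArc v + depthOfArc g u v))) newArcsUncovered ⟩
      ∑[ u < n ] ∑[ v < n ] (χ (arc g u v) * (underNewArc v + depthOfArc g u v))
    ≡⟨ sum-cong-≗ {n} (λ u → trans (sum-cong-≗ {n} (λ v → *-distribˡ-+ (χ (arc g u v)) _ _))
                                   (∑-distrib-+ {n} _ _)) ⟩
      ∑[ u < n ] (∑[ v < n ] (χ (arc g u v) * underNewArc v) + ∑[ v < n ] (χ (arc g u v) * depthOfArc g u v))
    ≡⟨ ∑-distrib-+ {n} _ _ ⟩
      newArcDepth + arcDepths g
    ∎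
    where
    open ≡-Reasoning
    newArcsUncovered : ∑[ v < suc n ] (χ (arc f zero v) * depthOfArc f zero v) ≡ 0
    newArcsUncovered = ∑-zero {suc n} (λ v →
      trans (cong (χ (arc f zero v) *_) (∑-zero {suc n} (λ i → ∑-zero {suc n} (λ j → *-zeroʳ (χ (arc f i j))))))
            (*-zeroʳ (χ (arc f zero v))))

  clear-from-new : ∀ y → clear f c (g y) zero (suc y) ≡ firstOfBoth y
  clear-from-new y = every-cong n (λ z →
    cong (λ t → not (t ∧ ((g z ≡ᵇ c) ∨ (g z ≡ᵇ g y))))
         (trans (cong (z ≺ y ∨_) (∧-zeroʳ (y ≺ z))) (∨-identityʳ (z ≺ y))))

  clear-to-new : ∀ x → clear f (g x) c (suc x) zero ≡ firstOfBoth x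
  clear-to-new x = every-cong n (λ z →
    cong₂ (λ t u → not (t ∧ u))
          (trans (cong (_∨ z ≺ x) (∧-zeroʳ (x ≺ z))) (∨-identityˡ (z ≺ x)))
          (∨-comm (g z ≡ᵇ g x) (g z ≡ᵇ c)))

  -- The new intertwining pairs join the new position to each y of another block that
  -- precedes every other element of its block and of block c; the two orders of the
  -- labels c, g y merge by trichotomy.
  intertwinings-step : intertwinings f ≡ newPairs + intertwinings g
  intertwinings-step = begin
      intertwinings f
    ≡⟨ cong₂ _+_ (cong₂ _+_ (cong (λ t → χ t * χ (clear f c c zero zero)) (<ᵇ-irrefl c))
                            (sum-cong-≗ {n} (λ y → cong (λ t → χ (c <ᵇ g y) * χ t) (clear-from-new y))))
                 (sum-cong-≗ {n} (λ x → cong (_+ row x) (cong (λ t → χ (g x <ᵇ c) * χ t) (clear-to-new x)))) ⟩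
      ∑[ y < n ] fromNew y + ∑[ x < n ] (toNew x + row x)
    ≡⟨ cong (∑[ y < n ] fromNew y +_) (∑-distrib-+ {n} toNew row) ⟩
      ∑[ y < n ] fromNew y + (∑[ x < n ] toNew x + intertwinings g)
    ≡⟨ sym (+-assoc (∑[ y < n ] fromNew y) _ _) ⟩
      (∑[ y < n ] fromNew y + ∑[ x < n ] toNew x) + intertwinings g
    ≡⟨ cong (_+ intertwinings g) (sym (∑-distrib-+ {n} fromNew toNew)) ⟩
      ∑[ y < n ] (fromNew y + toNew y) + intertwinings g
    ≡⟨ cong (_+ intertwinings g) (sum-cong-≗ {n} (λ y →
         trans (sym (*-distribʳ-+ (χ (firstOfBoth y)) (χ (c <ᵇ g y)) _))
               (cong (_* χ (firstOfBoth y)) (<ᵇ-trichotomy c (g y))))) ⟩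
      newPairs + intertwinings g
    ∎
    where
    open ≡-Reasoning
    fromNew toNew : Fin n → ℕ
    fromNew y = χ (c <ᵇ g y) * χ (firstOfBoth y)
    toNew x   = χ (g x <ᵇ c) * χ (firstOfBoth x)
    row : Fin n → ℕ
    row x = ∑[ y < n ] (χ (g x <ᵇ g y) * χ (clear g (g x) (g y) x y))

  balanced-step : ∀ ΔT → triangle (suc n) (arcCount f) ≡ ΔT + triangle n (arcCount g) →
                  ΔT + newArcDepth + newPairs ≡ n + newVertexDepth → Balanced n g → Balanced (suc n) f
  balanced-step ΔT triangle-step increments ih = begin
      triangle (suc n) (arcCount f) + arcDepths f + intertwinings f
    ≡⟨ cong₂ _+_ (cong₂ _+_ triangle-step arcDepths-step) intertwinings-step ⟩
      (ΔT + triangle n (arcCount g)) + (newArcDepth + arcDepths g) + (newPairs + intertwinings g)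
    ≡⟨ propagate {D = vertexDepths g} {c = n C 2} {n = n} {ΔT} {newArcDepth} {newPairs} {newVertexDepth} ih increments ⟩
      (n C 2 + n) + (newVertexDepth + vertexDepths g)
    ≡⟨ cong₂ _+_ (sym (C2-suc n)) (sym vertexDepths-step) ⟩
      suc n C 2 + vertexDepths f
    ∎
    where open ≡-Reasoning

  -- If c is a new label, the new position is a singleton block: no depth changes, the
  -- m terms of the triangle each grow by one, and each old block minimum forms a new pair.
  fresh-step : occurs c g ≡ false → Balanced n g → Balanced (suc n) f
  fresh-step fresh = balanced-step (arcCount g) triangle-step increments
    where
    open ≡-Reasoning
    c≢g : ∀ j → (c ≡ᵇ g j) ≡ false
    c≢g = some-false n fresh
    notUnder : ∀ v → underNewArc v ≡ 0
    notUnder v = ∑-zero {n} (λ j → cong (λ t → χ (t ∧ noEarlier c g j) * χ (v ≺ j)) (c≢g j))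
    newVertexDepth≡0 : newVertexDepth ≡ 0
    newVertexDepth≡0 = ∑-zero {n} notUnder
    newArcDepth≡0 : newArcDepth ≡ 0
    newArcDepth≡0 = ∑-zero {n} (λ u → ∑-zero {n} (λ v →
      trans (cong (χ (arc g u v) *_) (notUnder v)) (*-zeroʳ (χ (arc g u v)))))
    newPairs≡blockMins : newPairs ≡ ∑[ y < n ] χ (isBlockMin g y)
    newPairs≡blockMins = sum-cong-≗ {n} (λ y →
      trans (cong (λ t → χ (not t) * χ (firstOfBoth y)) (c≢g y))
     (trans (+-identityʳ _)
            (cong χ (every-cong n (λ z →
               cong (λ t → not (z ≺ y ∧ (t ∨ (g z ≡ᵇ g y)))) (trans (≡ᵇ-sym (g z) c) (c≢g z)))))))
    newArcs≡0 : newArcs ≡ 0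
    newArcs≡0 = ∑-zero {n} (λ j → cong (λ t → χ (t ∧ noEarlier c g j)) (c≢g j))
    triangle-step : triangle (suc n) (arcCount f) ≡ arcCount g + triangle n (arcCount g)
    triangle-step = begin
        triangle (suc n) (arcCount f)
      ≡⟨ cong (triangle (suc n)) (trans arcCount-step (cong (_+ arcCount g) newArcs≡0)) ⟩
        triangle (suc n) (arcCount g)
      ≡⟨ triangle-suc n (arcCount g) (subst (arcCount g ≤_) (arcs+blockMins n g) (m≤m+n _ _)) ⟩
        arcCount g + triangle n (arcCount g)
      ∎
    increments : arcCount g + newArcDepth + newPairs ≡ n + newVertexDepth
    increments = begin
        arcCount g + newArcDepth + newPairs
      ≡⟨ cong₂ (λ a b → arcCount g + a + b) newArcDepth≡0 newPairs≡blockMins ⟩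
        arcCount g + 0 + ∑[ y < n ] χ (isBlockMin g y)
      ≡⟨ cong (_+ ∑[ y < n ] χ (isBlockMin g y)) (+-identityʳ (arcCount g)) ⟩
        arcCount g + ∑[ y < n ] χ (isBlockMin g y)
      ≡⟨ arcs+blockMins n g ⟩
        n
      ≡⟨ sym (trans (cong (n +_) newVertexDepth≡0) (+-identityʳ n)) ⟩
        n + newVertexDepth
      ∎

  -- If c occurs in g, the new position joins its block through one new arc, ending at the
  -- first occurrence e of c. A position v < e is either a block minimum, giving a new
  -- pair, or the end of exactly one arc, now lying under the new arc.
  occurs-step : occurs c g ≡ true → Balanced n g → Balanced (suc n) f
  occurs-step occ = balanced-step n triangle-step increments
    where
    open ≡-Reasoning
    triangle-step : triangle (suc n) (arcCount f) ≡ n + triangle n (arcCount g)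
    triangle-step = begin
        triangle (suc n) (arcCount f)
      ≡⟨ cong (triangle (suc n)) (trans arcCount-step (cong (_+ arcCount g) (firstOcc-unique n g c occ))) ⟩
        triangle (suc n) (suc (arcCount g))
      ≡⟨ triangle-suc-suc n (arcCount g) ⟩
        n + triangle n (arcCount g)
      ∎

    not-∧-∨ : ∀ a p q → not (a ∧ (p ∨ q)) ≡ not (a ∧ p) ∧ not (a ∧ q)
    not-∧-∨ false p     q = refl
    not-∧-∨ true  true  q = refl
    not-∧-∨ true  false q = refl

    firstOfBoth-split : ∀ y → firstOfBoth y ≡ noEarlier c g y ∧ isBlockMin g y
    firstOfBoth-split y = trans
      (every-cong n (λ z → trans (cong (λ t → not (z ≺ y ∧ (t ∨ (g z ≡ᵇ g y)))) (≡ᵇ-sym (g z) c))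
                                 (not-∧-∨ (z ≺ y) (c ≡ᵇ g z) (g z ≡ᵇ g y))))
      (every-∧ n _ _)

    newPair-under : ∀ y → χ (not (c ≡ᵇ g y)) * χ (firstOfBoth y) ≡ underNewArc y * χ (isBlockMin g y)
    newPair-under y = begin
        χ (not (c ≡ᵇ g y)) * χ (firstOfBoth y)
      ≡⟨ cong (λ t → χ (not (c ≡ᵇ g y)) * χ t) (firstOfBoth-split y) ⟩
        χ (not (c ≡ᵇ g y)) * χ (noEarlier c g y ∧ isBlockMin g y)
      ≡⟨ cong (χ (not (c ≡ᵇ g y)) *_) (χ-∧ (noEarlier c g y) (isBlockMin g y)) ⟩
        χ (not (c ≡ᵇ g y)) * (χ (noEarlier c g y) * χ (isBlockMin g y))
      ≡⟨ sym (trans (cong (_* χ (isBlockMin g y)) (χ-∧ (not (c ≡ᵇ g y)) _))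
                    (*-assoc (χ (not (c ≡ᵇ g y))) _ _)) ⟩
        χ (not (c ≡ᵇ g y) ∧ noEarlier c g y) * χ (isBlockMin g y)
      ≡⟨ cong (_* χ (isBlockMin g y)) (beforeFirstOcc n g c occ y) ⟩
        ∑[ j < n ] χ (y ≺ j ∧ newArcEnd j) * χ (isBlockMin g y)
      ≡⟨ cong (_* χ (isBlockMin g y))
              (sum-cong-≗ {n} (λ j → trans (χ-∧ (y ≺ j) (newArcEnd j)) (*-comm (χ (y ≺ j)) _))) ⟩
        underNewArc y * χ (isBlockMin g y)
      ∎

    split-under : ∀ v → ∑[ u < n ] χ (arc g u v) * underNewArc v + underNewArc v * χ (isBlockMin g v) ≡ underNewArc v
    split-under v = begin
        ends * underNewArc v + underNewArc v * χ (isBlockMin g v)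
      ≡⟨ cong (ends * underNewArc v +_) (*-comm (underNewArc v) _) ⟩
        ends * underNewArc v + χ (isBlockMin g v) * underNewArc v
      ≡⟨ sym (*-distribʳ-+ (underNewArc v) ends _) ⟩
        (ends + χ (isBlockMin g v)) * underNewArc v
      ≡⟨ cong (_* underNewArc v) (trans (+-comm ends _) (blockMin-or-arcEnd n g v)) ⟩
        1 * underNewArc v
      ≡⟨ *-identityˡ (underNewArc v) ⟩
        underNewArc v
      ∎
      where
      ends : ℕ
      ends = ∑[ u < n ] χ (arc g u v)

    depth-balance : newArcDepth + newPairs ≡ newVertexDepth
    depth-balance = begin
        newArcDepth + newPairs
      ≡⟨ cong₂ _+_ (trans (∑-comm (λ u v → χ (arc g u v) * underNewArc v))
                          (sum-cong-≗ {n} (λ v → sym (*-distribʳ-sum (underNewArc v) (λ u → χ (arc g u v))))))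
                   (sum-cong-≗ {n} newPair-under) ⟩
        ∑[ v < n ] (∑[ u < n ] χ (arc g u v) * underNewArc v) + ∑[ v < n ] (underNewArc v * χ (isBlockMin g v))
      ≡⟨ sym (∑-distrib-+ {n} _ _) ⟩
        ∑[ v < n ] (∑[ u < n ] χ (arc g u v) * underNewArc v + underNewArc v * χ (isBlockMin g v))
      ≡⟨ sum-cong-≗ {n} split-under ⟩
        newVertexDepth
      ∎

    increments : n + newArcDepth + newPairs ≡ n + newVertexDepth
    increments = trans (+-assoc n newArcDepth newPairs) (cong (n +_) depth-balance)

  step : Balanced n g → Balanced (suc n) f
  step with occurs c g in eq
  ... | true  = occurs-step eq
  ... | false = fresh-step eq

balanced : ∀ n (f : Fin n → ℕ) → Balanced n f
balanced zero    f = refl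
balanced (suc n) f = Prepend.step f (balanced n (Prepend.g f))

tIndex-conv : ∀ {n} (f : Fin n → ℕ) →
              tIndex f ≡ (ℤ.+ triangle n (arcCount f) ℤ.- ℤ.+ vertexDepths f) ℤ.+ ℤ.+ arcDepths f
tIndex-conv {n} f = cong₂ (λ s e → s ℤ.+ ℤ.+ e)
  (cong₂ (λ a d → ℤ.+ a ℤ.- ℤ.+ d)
         (trans (cong (λ m → sum (map (λ i → n ∸ i) (map suc (upTo m)))) (arcCount-conv f))
                (triangle-conv n (arcCount f)))
         (vertexDepths-conv f))
  (arcDepths-conv f)

subtract-across : ∀ a d e i c → a + e + i ≡ c + d → (ℤ.+ a ℤ.- ℤ.+ d) ℤ.+ ℤ.+ e ℤ.+ ℤ.+ i ≡ ℤ.+ c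
subtract-across a d e i c eq = begin
    (ℤ.+ a ℤ.- ℤ.+ d) ℤ.+ ℤ.+ e ℤ.+ ℤ.+ i
  ≡⟨ regroup (ℤ.+ a) (ℤ.+ d) (ℤ.+ e) (ℤ.+ i) ⟩
    (ℤ.+ a ℤ.+ ℤ.+ e ℤ.+ ℤ.+ i) ℤ.- ℤ.+ d
  ≡⟨ cong (ℤ._- ℤ.+ d) (sym (trans (pos-+ (a + e) i) (cong (ℤ._+ ℤ.+ i) (pos-+ a e)))) ⟩
    ℤ.+ (a + e + i) ℤ.- ℤ.+ d
  ≡⟨ cong (λ t → ℤ.+ t ℤ.- ℤ.+ d) eq ⟩
    ℤ.+ (c + d) ℤ.- ℤ.+ d
  ≡⟨ cong (ℤ._- ℤ.+ d) (pos-+ c d) ⟩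
    (ℤ.+ c ℤ.+ ℤ.+ d) ℤ.- ℤ.+ d
  ≡⟨ cancel (ℤ.+ c) (ℤ.+ d) ⟩
    ℤ.+ c
  ∎
  where
  open ≡-Reasoning
  regroup : ∀ A D E I → (A ℤ.- D) ℤ.+ E ℤ.+ I ≡ (A ℤ.+ E ℤ.+ I) ℤ.- D
  regroup = ℤ-Solver.solve-∀
  cancel : ∀ X Y → (X ℤ.+ Y) ℤ.- Y ≡ X
  cancel = ℤ-Solver.solve-∀

mainTheorem1 : (n : ℕ) → 1 ≤ n → (f : Fin n → ℕ) → tIndex f ℤ.+ (ℤ.+ iNumber f) ≡ ℤ.+ (n C 2)
mainTheorem1 n _ f = begin
    tIndex f ℤ.+ ℤ.+ iNumber f
  ≡⟨ cong₂ (λ t i → t ℤ.+ ℤ.+ i) (tIndex-conv f) (intertwinings-conv f) ⟩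
    (ℤ.+ triangle n (arcCount f) ℤ.- ℤ.+ vertexDepths f) ℤ.+ ℤ.+ arcDepths f ℤ.+ ℤ.+ intertwinings f
  ≡⟨ subtract-across (triangle n (arcCount f)) (vertexDepths f) (arcDepths f) (intertwinings f) (n C 2)
                     (balanced n f) ⟩
    ℤ.+ (n C 2)
  ∎
  where open ≡-Reasoning
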